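{- Let $\mathcal{T}$ be a BSTSO instance with maximum tree size $k$, and let $\mathcal{R}$ be the set of trees remaining after the procedure described below. Building each tree $T\in\mathcal{R}$ separately from scratch (using $|T|-1$ gates) yields a solution for $\mathcal{R}$ of size at most $\frac23 k\cdot\mathrm{opt}(\mathcal{R})$.
   Context: BSTSO: Fix an associative, commutative binary operator $\circ$ on $\{0,1\}$. An instance is a finite family $\mathcal{T}$ of subsets of $\{1,\dots,n\}$ (trees), $k:=\max_{T\in\mathcal{T}}|T|$. A circuit is a directed acyclic graph with inputs (in-degree $0$, each associated with a variable $x_i$) and gates (in-degree $2$); each vertex $v$ has a variable set $S(v)$, with $S(v)=\{i\}$ for the input of $x_i$ and, for a gate with predecessors $u,w$, $S(u)\cap S(w)=\emptyset$ and $S(v)=S(u)\cup S(w)$. A solution for a family is a circuit in which every member equals $S(v)$ for some vertex $v$; $\mathrm{opt}(\cdot)$ is the minimum number of gates of a solution. Procedure: let $\mathcal{T}^{\supsetneq}:=\{T\in\mathcal{T}:\exists T'\in\mathcal{T},\ T'\subsetneq T,\ |T'|\ge k/3\}$ and set $\mathcal{T}:=\mathcal{T}\setminus\mathcal{T}^{\supsetneq}$. For $i=2,3,\dots,|\mathcal{T}|$: while there exists a set $S$ with $|S|\ge\frac{i}{3(i-1)}k$ and $S\subseteq T$ for at least $i$ trees $T\in\mathcal{T}$, remove from $\mathcal{T}$ all trees containing $S$. $\mathcal{R}$ is the resulting $\mathcal{T}$. -}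

module Defs where

open import Data.Nat using (ℕ; zero; suc; _+_; _*_; _∸_; _≤_; _<_; _≤?_; _⊔_)
open import Data.Fin using (Fin; zero; suc)
open import Data.Fin.Properties using (any?)
open import Data.Fin.Subset using (Subset; _⊆_; _⊂_; _∈_; _∉_; ∣_∣; ⁅_⁆; _∪_; _∩_; Empty)
open import Data.Fin.Subset.Properties using (_⊆?_; _∈?_)
open import Data.List using (List; []; _∷_; filter; length; map; foldr)
open import Data.Nat.ListAction using (sum)
open import Data.List.Membership.Propositional using () renaming (_∈_ to _∈ₗ_)
open import Data.List.Relation.Unary.Any using (Any)
import Data.List.Relation.Unary.Any as Any
open import Data.Sum using (_⊎_; inj₁; inj₂)
open import Data.Product using (Σ; ∃; _×_; _,_)
open import Data.Unit using (⊤)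
open import Relation.Nullary using (¬_; Dec; ¬?)
open import Relation.Nullary.Decidable using (_×-dec_)
open import Relation.Binary.PropositionalEquality using (_≡_)

-- Families of trees: a finite family of subsets of {1..n} is a list of
-- `Subset n` (variables are indexed by Fin n); duplicate-freeness is
-- imposed as a hypothesis in the statement.

Family : ℕ → Set
Family n = List (Subset n)

maxSize : ∀ {n} → Family n → ℕ
maxSize 𝒯 = foldr _⊔_ 0 (map ∣_∣ 𝒯)

-- Gates are added one at a time; the newest gate is `inj₂ zero`, and its
-- two predecessors are vertices of the circuit built so far (so the graph
-- is acyclic by construction).  Inputs: one per variable (extra inputs for
-- the same variable never matter, since inputs are not counted).

Vtx : ℕ → ℕ → Set
Vtx n m = Fin n ⊎ Fin m

data Circuit (n : ℕ) : ℕ → Set where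
  []  : Circuit n zero
  _▷_ : ∀ {m} → Circuit n m → Vtx n m × Vtx n m → Circuit n (suc m)

S : ∀ {n m} → Circuit n m → Vtx n m → Subset n
S c              (inj₁ i)       = ⁅ i ⁆
S (c ▷ (u , w))  (inj₂ zero)    = S c u ∪ S c w
S (c ▷ _)        (inj₂ (suc j)) = S c (inj₂ j)

Valid : ∀ {n m} → Circuit n m → Set
Valid []            = ⊤
Valid (c ▷ (u , w)) = Valid c × Empty (S c u ∩ S c w)

IsSolution : ∀ {n m} → Family n → Circuit n m → Set
IsSolution {n} {m} 𝒯 c =
  Valid c × (∀ {T} → T ∈ₗ 𝒯 → Σ (Vtx n m) λ v → S c v ≡ T)

IsOpt : ∀ {n} → Family n → ℕ → Set
IsOpt {n} 𝒯 m =
  (Σ (Circuit n m) λ c → IsSolution 𝒯 c) ×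
  (∀ {m'} (c : Circuit n m') → IsSolution 𝒯 c → m ≤ m')

_⊂?_ : ∀ {n} (p q : Subset n) → Dec (p ⊂ q)
p ⊂? q = (p ⊆? q) ×-dec any? (λ x → (x ∈? q) ×-dec ¬? (x ∈? p))

HasLargeProperSubtree : ∀ {n} → ℕ → Family n → Subset n → Set
HasLargeProperSubtree k 𝒯 T = Any (λ T' → T' ⊂ T × k ≤ 3 * ∣ T' ∣) 𝒯

hasLargeProperSubtree? : ∀ {n} k (𝒯 : Family n) T → Dec (HasLargeProperSubtree k 𝒯 T)
hasLargeProperSubtree? k 𝒯 T = Any.any? (λ T' → (T' ⊂? T) ×-dec (k ≤? 3 * ∣ T' ∣)) 𝒯

removeSupersets : ∀ {n} → ℕ → Family n → Family n
removeSupersets k 𝒯 = filter (λ T → ¬? (hasLargeProperSubtree? k 𝒯 T)) 𝒯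

containing : ∀ {n} → Subset n → Family n → Family n
containing s 𝒯 = filter (s ⊆?_) 𝒯

removeContaining : ∀ {n} → Subset n → Family n → Family n
removeContaining s 𝒯 = filter (λ T → ¬? (s ⊆? T)) 𝒯

-- S qualifies in round i:  |S| ≥ i/(3(i-1)) · k  (i ≥ 2, so cleared of
-- denominators: 3(i-1)|S| ≥ i·k), and S ⊆ T for at least i trees T ∈ 𝒯
Qualifies : ∀ {n} → ℕ → ℕ → Family n → Subset n → Set
Qualifies k i 𝒯 s = i * k ≤ 3 * (i ∸ 1) * ∣ s ∣ × i ≤ length (containing s 𝒯)

-- the while loop of round i (nondeterministic choice of S), run until no
-- qualifying S exists
data WhileLoop {n} (k i : ℕ) : Family n → Family n → Set where
  done : ∀ {𝒯} → (¬ Σ (Subset n) λ s → Qualifies k i 𝒯 s) → WhileLoop k i 𝒯 𝒯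
  step : ∀ {𝒯 𝒰} (s : Subset n) → Qualifies k i 𝒯 s →
         WhileLoop k i (removeContaining s 𝒯) 𝒰 → WhileLoop k i 𝒯 𝒰

data Rounds {n} (k : ℕ) : ℕ → ℕ → Family n → Family n → Set where
  stop : ∀ {i N 𝒯} → N < i → Rounds k i N 𝒯 𝒯
  next : ∀ {i N 𝒯 𝒰 𝒱} → i ≤ N → WhileLoop k i 𝒯 𝒰 →
         Rounds k (suc i) N 𝒰 𝒱 → Rounds k i N 𝒯 𝒱

Procedure : ∀ {n} → Family n → Family n → Set
Procedure 𝒯 𝓡 =
  let k  = maxSize 𝒯
      𝒯₁ = removeSupersets k 𝒯
  in Rounds k 2 (length 𝒯₁) 𝒯₁ 𝓡

separateCost : ∀ {n} → Family n → ℕ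
separateCost 𝓡 = sum (map (λ T → ∣ T ∣ ∸ 1) 𝓡)

-- Let c be any circuit computing every tree of 𝓡.  A gate
-- computing X pays 2k to the tree X (if X ∈ 𝓡) and 3|X| − k to every tree of 𝓡
-- properly containing X.  A tree T built by a gate with children u, w gets 2k
-- from that gate and at least 3|S u| − k − 1 and 3|S w| − k − 1 from the children
-- (an input has size 1, and k ≥ 2 once |T| ≥ 2), in total at least 3(|T| − 1).
-- No gate pays more than 2k: if X ∈ 𝓡 and 3|X| ≥ k, no tree of 𝓡 properly
-- contains X, as 𝒯^⊋ was removed; if X ∉ 𝓡, the c trees containing X survived
-- round c of the procedure, so 3(c − 1)|X| < ck, which gives c(3|X| − k) ≤ 2k.
-- Summing over all gates, 3 Σ_T (|T| − 1) ≤ 2k · (number of gates).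
module Submission where

open import Defs
open import Data.Nat using (ℕ; _*_; _≤_)
open import Data.List.Relation.Unary.Unique.Propositional using (Unique)

import Data.Bool.Properties as Boolₚ
open import Data.Fin using (zero; suc)
import Data.Fin.Properties as Finₚ
open import Data.Fin.Subset using (Subset; _∪_; ∣_∣; outside; inside)
  renaming (_⊆_ to _⊆ₛ_; _⊂_ to _⊂ₛ_)
open import Data.Fin.Subset.Properties
  using (_⊆?_; _∈?_; ⊆-antisym; ∣⁅x⁆∣≡1; p⊆q⇒∣p∣≤∣q∣; p⊆p∪q; q⊆p∪q; ∪-idem)
open import Data.List using (List; []; _∷_; map; filter; length)
open import Data.List.Membership.DecPropositional using () renaming (_∈?_ to _∈ₗ?_)
open import Data.List.Membership.Propositional using (lose) renaming (_∈_ to _∈ₗ_)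
open import Data.List.Membership.Propositional.Properties using (∈-filter⁻)
open import Data.List.Properties using (filter-none; length-filter)
open import Data.List.Relation.Binary.Sublist.Propositional using ([]; _∷_; _∷ʳ_)
  renaming (_⊆_ to _⊑_; ⊆-refl to ⊑-refl; ⊆-trans to ⊑-trans)
open import Data.List.Relation.Binary.Sublist.Propositional.Properties
  using (All-resp-⊆; Any-resp-⊆; length-mono-≤)
  renaming (filter⁺ to filter⁺-⊑; filter-⊆ to filter-⊑)
import Data.List.Relation.Unary.All as All
open import Data.List.Relation.Unary.AllPairs using ([]; _∷_)
open import Data.List.Relation.Unary.Any using (here; there)
import Data.List.Relation.Unary.Unique.Propositional.Properties as Uniqueₚ
open import Data.Nat using (suc; _+_; _∸_; _<_; z≤n; s≤s)
open import Data.Nat.ListAction using (sum)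
open import Data.Nat.Properties
open import Algebra.Properties.CommutativeSemigroup +-commutativeSemigroup
  using () renaming (interchange to +-interchange)
open import Data.Nat.Solver using (module +-*-Solver)
open +-*-Solver using (solve; _:+_; _:*_; _:=_; con)
open import Data.Product using (Σ; _×_; _,_; proj₁; proj₂)
open import Data.Sum using (inj₁; inj₂; [_,_]′)
import Data.Sum.Properties as Sumₚ
open import Data.Vec using ([]; _∷_)
import Data.Vec.Properties as Vecₚ
open import Function using (_∘_)
open import Relation.Binary.Definitions using (DecidableEquality)
open import Relation.Binary.PropositionalEquality
  using (_≡_; _≢_; refl; sym; trans; cong; cong₂)
open import Relation.Nullary using (¬_; Dec; yes; no; ¬?; contradiction)
open import Relation.Nullary.Decidable using (decidable-stable; toSum)
open import Relation.Unary using (Pred; Decidable)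

when : ∀ {p} {P : Set p} → Dec P → ℕ → ℕ
when (yes _) x = x
when (no  _) _ = 0

module _ {a} {A : Set a} where

  sum-map-+ : ∀ (f g : A → ℕ) xs →
              sum (map (λ x → f x + g x) xs) ≡ sum (map f xs) + sum (map g xs)
  sum-map-+ f g []       = refl
  sum-map-+ f g (x ∷ xs) =
    trans (cong (f x + g x +_) (sum-map-+ f g xs)) (+-interchange (f x) (g x) _ _)

  *-sum-map : ∀ c (f : A → ℕ) xs → c * sum (map f xs) ≡ sum (map (λ x → c * f x) xs)
  *-sum-map c f []       = *-zeroʳ c
  *-sum-map c f (x ∷ xs) = trans (*-distribˡ-+ c (f x) _) (cong (c * f x +_) (*-sum-map c f xs))

  sum-map-mono : ∀ (f g : A → ℕ) xs → (∀ {x} → x ∈ₗ xs → f x ≤ g x) →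
                 sum (map f xs) ≤ sum (map g xs)
  sum-map-mono f g []       f≤g = z≤n
  sum-map-mono f g (x ∷ xs) f≤g = +-mono-≤ (f≤g (here refl)) (sum-map-mono f g xs (f≤g ∘ there))

  sum-map-≤-const : ∀ (f : A → ℕ) c xs → (∀ x → f x ≤ c) → sum (map f xs) ≤ length xs * c
  sum-map-≤-const f c []       f≤c = z≤n
  sum-map-≤-const f c (x ∷ xs) f≤c = +-mono-≤ (f≤c x) (sum-map-≤-const f c xs f≤c)

  sum-map-when : ∀ {p} {P : Pred A p} (P? : Decidable P) c xs →
                 sum (map (λ x → when (P? x) c) xs) ≡ length (filter P? xs) * c
  sum-map-when P? c []       = refl
  sum-map-when P? c (x ∷ xs) with P? x
  ... | yes _ = cong (c +_) (sum-map-when P? c xs)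
  ... | no  _ = sum-map-when P? c xs

sum-map-comm : ∀ {a b} {A : Set a} {B : Set b} (F : A → B → ℕ) xs ys →
               sum (map (λ x → sum (map (F x) ys)) xs) ≡ sum (map (λ y → sum (map (λ x → F x y) xs)) ys)
sum-map-comm F []       ys = sym (sum-map-0 ys)
  where
  sum-map-0 : ∀ ys → sum (map (λ _ → 0) ys) ≡ 0
  sum-map-0 []       = refl
  sum-map-0 (_ ∷ ys) = sum-map-0 ys
sum-map-comm F (x ∷ xs) ys =
  trans (cong (sum (map (F x) ys) +_) (sum-map-comm F xs ys)) (sym (sum-map-+ (F x) _ ys))

module _ {a} {A : Set a} (_≟_ : DecidableEquality A) where

  length-filter-≟-unique : ∀ {y xs} → Unique xs → length (filter (y ≟_) xs) ≤ 1
  length-filter-≟-unique []                     = z≤n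
  length-filter-≟-unique {y} {x ∷ xs} (x∉xs ∷ u) with y ≟ x
  ... | yes refl = s≤s (≤-reflexive (cong length (filter-none (y ≟_) x∉xs)))
  ... | no _     = length-filter-≟-unique u

first∈ : ∀ {a} {A : Set a} {xs : List A} → 1 ≤ length xs → Σ A (_∈ₗ xs)
first∈ {xs = x ∷ _} _ = x , here refl

Unique-resp-⊑ : ∀ {a} {A : Set a} {xs ys : List A} → xs ⊑ ys → Unique ys → Unique xs
Unique-resp-⊑ []         []         = []
Unique-resp-⊑ (_ ∷ʳ xs⊑) (_ ∷ u)    = Unique-resp-⊑ xs⊑ u
Unique-resp-⊑ (refl ∷ xs⊑) (y∉ ∷ u) = All-resp-⊆ xs⊑ y∉ ∷ Unique-resp-⊑ xs⊑ u

∣p∪q∣≤∣p∣+∣q∣ : ∀ {n} (p q : Subset n) → ∣ p ∪ q ∣ ≤ ∣ p ∣ + ∣ q ∣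
∣p∪q∣≤∣p∣+∣q∣ []            []            = z≤n
∣p∪q∣≤∣p∣+∣q∣ (outside ∷ p) (outside ∷ q) = ∣p∪q∣≤∣p∣+∣q∣ p q
∣p∪q∣≤∣p∣+∣q∣ (outside ∷ p) (inside  ∷ q) =
  ≤-trans (s≤s (∣p∪q∣≤∣p∣+∣q∣ p q)) (≤-reflexive (sym (+-suc ∣ p ∣ ∣ q ∣)))
∣p∪q∣≤∣p∣+∣q∣ (inside  ∷ p) (outside ∷ q) = s≤s (∣p∪q∣≤∣p∣+∣q∣ p q)
∣p∪q∣≤∣p∣+∣q∣ (inside  ∷ p) (inside  ∷ q) =
  s≤s (≤-trans (∣p∪q∣≤∣p∣+∣q∣ p q) (+-monoʳ-≤ ∣ p ∣ (n≤1+n ∣ q ∣)))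

p⊆q∧p≢q⇒p⊂q : ∀ {n} {p q : Subset n} → p ⊆ₛ q → p ≢ q → p ⊂ₛ q
p⊆q∧p≢q⇒p⊂q {p = p} {q} p⊆q p≢q with p ⊂? q
... | yes p⊂q = p⊂q
... | no  p⊄q = contradiction (⊆-antisym p⊆q q⊆p) p≢q
  where
  q⊆p : q ⊆ₛ p
  q⊆p {x} x∈q = decidable-stable (x ∈? p) (λ x∉p → p⊄q (p⊆q , x , x∈q , x∉p))

_≟ₛ_ : ∀ {n} → DecidableEquality (Subset n)
_≟ₛ_ = Vecₚ.≡-dec Boolₚ._≟_

_≟ᵥ_ : ∀ {n m} → DecidableEquality (Vtx n m)
_≟ᵥ_ = Sumₚ.≡-dec Finₚ._≟_ Finₚ._≟_

gateSets : ∀ {n m} → Circuit n m → List (Subset n)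
gateSets []            = []
gateSets (c ▷ (u , w)) = S c u ∪ S c w ∷ gateSets c

length-gateSets : ∀ {n m} (c : Circuit n m) → length (gateSets c) ≡ m
length-gateSets []      = refl
length-gateSets (c ▷ _) = cong suc (length-gateSets c)

gateSum : ∀ {n m} → (Subset n → ℕ) → Circuit n m → ℕ
gateSum f c = sum (map f (gateSets c))

weightAt : ∀ {n m} → (Subset n → ℕ) → Circuit n m → Vtx n m → ℕ
weightAt f c (inj₁ _) = 0
weightAt f c (inj₂ j) = f (S c (inj₂ j))

weightAt≤gateSum : ∀ {n m} f (c : Circuit n m) v → weightAt f c v ≤ gateSum f c
weightAt≤gateSum f c             (inj₁ _)       = z≤n
weightAt≤gateSum f (c ▷ (u , w)) (inj₂ zero)    = m≤m+n _ _
weightAt≤gateSum f (c ▷ (u , w)) (inj₂ (suc j)) = ≤-trans (weightAt≤gateSum f c (inj₂ j)) (m≤n+m _ _)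

weightAt-pair≤gateSum : ∀ {n m} f (c : Circuit n m) u v → u ≢ v →
                        weightAt f c u + weightAt f c v ≤ gateSum f c
weightAt-pair≤gateSum f c (inj₁ _) v _ = weightAt≤gateSum f c v
weightAt-pair≤gateSum f c (inj₂ i) (inj₁ _) _ =
  ≤-trans (≤-reflexive (+-identityʳ _)) (weightAt≤gateSum f c (inj₂ i))
weightAt-pair≤gateSum f (c ▷ (u , w)) (inj₂ zero) (inj₂ zero) u≢v = contradiction refl u≢v
weightAt-pair≤gateSum f (c ▷ (u , w)) (inj₂ zero) (inj₂ (suc j)) _ =
  +-monoʳ-≤ _ (weightAt≤gateSum f c (inj₂ j))
weightAt-pair≤gateSum f (c ▷ (u , w)) (inj₂ (suc i)) (inj₂ zero) _ =
  ≤-trans (≤-reflexive (+-comm (f (S c (inj₂ i))) _)) (+-monoʳ-≤ _ (weightAt≤gateSum f c (inj₂ i)))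
weightAt-pair≤gateSum f (c ▷ (u , w)) (inj₂ (suc i)) (inj₂ (suc j)) u≢v =
  ≤-trans (weightAt-pair≤gateSum f c (inj₂ i) (inj₂ j) λ { refl → u≢v refl }) (m≤n+m _ _)

-- 3(c − 1)a < ck gives (c − 1)(3a − k) ≤ k, and c ≤ 2(c − 1) once c ≥ 2.
sharing-bound : ∀ c a k → (1 ≤ c → a ≤ k) → (2 ≤ c → 3 * (c ∸ 1) * a < c * k) →
                c * (3 * a ∸ k) ≤ 2 * k
sharing-bound 0 a k _ _ = z≤n
sharing-bound 1 a k a≤k _ =
  ≤-trans (≤-reflexive (*-identityˡ _)) (m≤n+o⇒m∸n≤o (3 * a) k (*-monoʳ-≤ 3 (a≤k (s≤s z≤n))))
sharing-bound (suc d@(suc _)) a k _ shared = begin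
  y + d * y      ≤⟨ +-monoˡ-≤ (d * y) (m≤n*m y d) ⟩
  d * y + d * y  ≤⟨ +-mono-≤ dy≤k dy≤k ⟩
  k + k          ≡⟨ cong (k +_) (+-identityʳ k) ⟨
  2 * k          ∎
  where
  open ≤-Reasoning
  y = 3 * a ∸ k
  d3a≤dk+k : d * (3 * a) ≤ d * k + k
  d3a≤dk+k = begin
    d * (3 * a)  ≡⟨ solve 2 (λ d a → d :* (con 3 :* a) := con 3 :* d :* a) refl d a ⟩
    3 * d * a    ≤⟨ <⇒≤ (shared (s≤s (s≤s z≤n))) ⟩
    k + d * k    ≡⟨ +-comm k (d * k) ⟩
    d * k + k    ∎
  dy≤k : d * y ≤ k
  dy≤k = ≤-trans (≤-reflexive (*-distribˡ-∸ d (3 * a) k)) (m≤n+o⇒m∸n≤o (d * (3 * a)) (d * k) d3a≤dk+k)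

#containing : ∀ {n} → Subset n → Family n → ℕ
#containing X 𝓡 = length (containing X 𝓡)

record Reduced {n} (k : ℕ) (𝓡 : Family n) : Set where
  field
    unique               : Unique 𝓡
    size≤                : ∀ {T} → T ∈ₗ 𝓡 → ∣ T ∣ ≤ k
    proper-subtree-small : ∀ {X T} → X ∈ₗ 𝓡 → T ∈ₗ 𝓡 → X ⊂ₛ T → 3 * ∣ X ∣ < k
    shared-subset-small  : ∀ X → 2 ≤ #containing X 𝓡 →
                           3 * (#containing X 𝓡 ∸ 1) * ∣ X ∣ < #containing X 𝓡 * k

module Charging {n k : ℕ} {𝓡 : Family n} (reduced : Reduced k 𝓡) where

  open Reduced reduced

  excess : Subset n → ℕ
  excess X = 3 * ∣ X ∣ ∸ k

  charge : Subset n → Subset n → ℕ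
  charge T X = when (X ≟ₛ T) (2 * k) + when (X ⊂? T) (excess X)

  #copies #containing-properly : Subset n → ℕ
  #copies X             = length (filter (X ≟ₛ_) 𝓡)
  #containing-properly X = length (filter (X ⊂?_) 𝓡)

  charge-self : ∀ T → 2 * k ≤ charge T T
  charge-self T with T ≟ₛ T
  ... | yes _   = m≤m+n _ _
  ... | no T≢T = contradiction refl T≢T

  charge-⊆ : ∀ {T X} → T ∈ₗ 𝓡 → X ⊆ₛ T → 3 * ∣ X ∣ ≤ k + charge T X
  charge-⊆ {T} {X} T∈𝓡 X⊆T with X ≟ₛ T | X ⊂? T
  ... | yes refl | _       = ≤-trans (*-monoʳ-≤ 3 (size≤ T∈𝓡)) (+-monoʳ-≤ k (m≤m+n _ _))
  ... | no X≢T  | yes _   = m≤n+m∸n (3 * ∣ X ∣) k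
  ... | no X≢T  | no X⊄T = contradiction (p⊆q∧p≢q⇒p⊂q X⊆T X≢T) X⊄T

  charge-vertex : ∀ {m T} (c : Circuit n m) v → 2 ≤ k → T ∈ₗ 𝓡 → S c v ⊆ₛ T →
                  3 * ∣ S c v ∣ ≤ suc k + weightAt (charge T) c v
  charge-vertex c (inj₁ i) 2≤k _   _   rewrite ∣⁅x⁆∣≡1 i = s≤s (≤-trans 2≤k (m≤m+n k 0))
  charge-vertex c (inj₂ j) _   T∈𝓡 v⊆T = ≤-trans (charge-⊆ T∈𝓡 v⊆T) (n≤1+n _)

  charge-children : ∀ {m} (c : Circuit n m) u w → 2 ≤ k → S c u ∪ S c w ∈ₗ 𝓡 →
                    3 * ∣ S c u ∪ S c w ∣ ≤ 2 + (2 * k + gateSum (charge (S c u ∪ S c w)) c)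
  charge-children c u w 2≤k T∈𝓡 with u ≟ᵥ w
  ... | yes refl = begin
    3 * ∣ S c u ∪ S c u ∣  ≡⟨ cong (λ X → 3 * ∣ X ∣) (∪-idem (S c u)) ⟩
    3 * ∣ S c u ∣          ≤⟨ charge-vertex c u 2≤k T∈𝓡 (p⊆p∪q (S c u)) ⟩
    suc k + Wu             ≤⟨ +-monoʳ-≤ (suc k) (≤-trans (weightAt≤gateSum (charge T) c u) (m≤n+m G (suc k))) ⟩
    suc k + (suc k + G)    ≡⟨ solve 2 (λ k G → (con 1 :+ k) :+ ((con 1 :+ k) :+ G)
                                              := con 2 :+ (con 2 :* k :+ G)) refl k G ⟩
    2 + (2 * k + G)        ∎
    where
    open ≤-Reasoning
    T  = S c u ∪ S c u
    G  = gateSum (charge T) c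
    Wu = weightAt (charge T) c u
  ... | no u≢w = begin
    3 * ∣ S c u ∪ S c w ∣            ≤⟨ *-monoʳ-≤ 3 (∣p∪q∣≤∣p∣+∣q∣ (S c u) (S c w)) ⟩
    3 * (∣ S c u ∣ + ∣ S c w ∣)      ≡⟨ *-distribˡ-+ 3 ∣ S c u ∣ ∣ S c w ∣ ⟩
    3 * ∣ S c u ∣ + 3 * ∣ S c w ∣    ≤⟨ +-mono-≤ (charge-vertex c u 2≤k T∈𝓡 (p⊆p∪q (S c w)))
                                                 (charge-vertex c w 2≤k T∈𝓡 (q⊆p∪q (S c u) (S c w))) ⟩
    (suc k + Wu) + (suc k + Ww)      ≡⟨ solve 3 (λ k U W → (con 1 :+ k :+ U) :+ (con 1 :+ k :+ W)
                                                        := con 2 :+ (con 2 :* k :+ (U :+ W))) refl k Wu Ww ⟩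
    2 + (2 * k + (Wu + Ww))          ≤⟨ +-monoʳ-≤ 2 (+-monoʳ-≤ (2 * k)
                                          (weightAt-pair≤gateSum (charge T) c u w u≢w)) ⟩
    2 + (2 * k + G)                  ∎
    where
    open ≤-Reasoning
    T  = S c u ∪ S c w
    G  = gateSum (charge T) c
    Wu = weightAt (charge T) c u
    Ww = weightAt (charge T) c w

  charge-built : ∀ {m T} (c : Circuit n m) v → T ∈ₗ 𝓡 → S c v ≡ T →
                 3 * (∣ T ∣ ∸ 1) ≤ gateSum (charge T) c
  charge-built c (inj₁ i) _ refl rewrite ∣⁅x⁆∣≡1 i = z≤n
  charge-built (c ▷ _) (inj₂ (suc j)) T∈𝓡 Sv≡T =
    ≤-trans (charge-built c (inj₂ j) T∈𝓡 Sv≡T) (m≤n+m _ _)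
  charge-built (c ▷ (u , w)) (inj₂ zero) T∈𝓡 refl with 2 ≤? k
  ... | no 2≰k rewrite m≤n⇒m∸n≡0 (≤-trans (size≤ T∈𝓡) (≤-pred (≰⇒> 2≰k))) = z≤n
  ... | yes 2≤k = begin
    3 * (∣ T ∣ ∸ 1)          ≡⟨ *-distribˡ-∸ 3 ∣ T ∣ 1 ⟩
    3 * ∣ T ∣ ∸ 3            ≤⟨ ∸-monoˡ-≤ 3 (charge-children c u w 2≤k T∈𝓡) ⟩
    2 + (2 * k + G) ∸ 3      ≤⟨ m≤n+o⇒m∸n≤o (2 + (2 * k + G)) 3 (n≤1+n _) ⟩
    2 * k + G                ≤⟨ +-monoˡ-≤ G (charge-self T) ⟩
    charge T T + G           ∎
    where
    open ≤-Reasoning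
    T = S c u ∪ S c w
    G = gateSum (charge T) c

  #containing-properly≤#containing : ∀ X → #containing-properly X ≤ #containing X 𝓡
  #containing-properly≤#containing X =
    length-mono-≤ (filter⁺-⊑ (X ⊂?_) (X ⊆?_) (λ { refl → proj₁ }) (⊑-refl {x = 𝓡}))

  containing-size : ∀ {X} → 1 ≤ #containing X 𝓡 → ∣ X ∣ ≤ k
  containing-size {X} 1≤# with T , T∈ ← first∈ 1≤# with T∈𝓡 , X⊆T ← ∈-filter⁻ (X ⊆?_) T∈ =
    ≤-trans (p⊆q⇒∣p∣≤∣q∣ X⊆T) (size≤ T∈𝓡)

  charge-total-∈ : ∀ {X} → X ∈ₗ 𝓡 → #copies X * (2 * k) + #containing-properly X * excess X ≤ 2 * k
  charge-total-∈ {X} X∈𝓡 = ≤-trans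
    (+-mono-≤ (*-monoˡ-≤ (2 * k) (length-filter-≟-unique _≟ₛ_ unique)) (≤-reflexive no-proper-charge))
    (≤-reflexive (trans (+-identityʳ _) (*-identityˡ _)))
    where
    no-proper-charge : #containing-properly X * excess X ≡ 0
    no-proper-charge with 3 * ∣ X ∣ ≤? k
    ... | yes 3X≤k rewrite m≤n⇒m∸n≡0 3X≤k = *-zeroʳ (#containing-properly X)
    ... | no  3X≰k rewrite filter-none (X ⊂?_) (All.tabulate λ T∈𝓡 X⊂T →
                             3X≰k (<⇒≤ (proper-subtree-small X∈𝓡 T∈𝓡 X⊂T))) = refl

  charge-total-∉ : ∀ {X} → ¬ X ∈ₗ 𝓡 → #copies X * (2 * k) + #containing-properly X * excess X ≤ 2 * k
  charge-total-∉ {X} X∉𝓡 rewrite filter-none (X ≟ₛ_) (All.tabulate λ { T∈𝓡 refl → X∉𝓡 T∈𝓡 }) = begin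
    #containing-properly X * excess X  ≤⟨ *-monoˡ-≤ (excess X) (#containing-properly≤#containing X) ⟩
    #containing X 𝓡 * excess X         ≤⟨ sharing-bound (#containing X 𝓡) ∣ X ∣ k
                                            containing-size (shared-subset-small X) ⟩
    2 * k                              ∎
    where open ≤-Reasoning

  charge-total : ∀ X → sum (map (λ T → charge T X) 𝓡) ≤ 2 * k
  charge-total X = begin
    sum (map (λ T → charge T X) 𝓡)
      ≡⟨ sum-map-+ (λ T → when (X ≟ₛ T) (2 * k)) (λ T → when (X ⊂? T) (excess X)) 𝓡 ⟩
    sum (map (λ T → when (X ≟ₛ T) (2 * k)) 𝓡) + sum (map (λ T → when (X ⊂? T) (excess X)) 𝓡)
      ≡⟨ cong₂ _+_ (sum-map-when (X ≟ₛ_) (2 * k) 𝓡) (sum-map-when (X ⊂?_) (excess X) 𝓡) ⟩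
    #copies X * (2 * k) + #containing-properly X * excess X
      ≤⟨ [ charge-total-∈ , charge-total-∉ ]′ (toSum (_∈ₗ?_ _≟ₛ_ X 𝓡)) ⟩
    2 * k ∎
    where open ≤-Reasoning

  separateCost-bound : ∀ {m} (c : Circuit n m) → (∀ {T} → T ∈ₗ 𝓡 → Σ (Vtx n m) λ v → S c v ≡ T) →
                       3 * separateCost 𝓡 ≤ 2 * k * m
  separateCost-bound {m} c builds = begin
    3 * separateCost 𝓡                               ≡⟨ *-sum-map 3 (λ T → ∣ T ∣ ∸ 1) 𝓡 ⟩
    sum (map (λ T → 3 * (∣ T ∣ ∸ 1)) 𝓡)              ≤⟨ sum-map-mono _ _ 𝓡 charge-tree ⟩
    sum (map (λ T → gateSum (charge T) c) 𝓡)         ≡⟨ sum-map-comm charge 𝓡 (gateSets c) ⟩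
    gateSum (λ X → sum (map (λ T → charge T X) 𝓡)) c ≤⟨ sum-map-≤-const _ (2 * k) (gateSets c) charge-total ⟩
    length (gateSets c) * (2 * k)                    ≡⟨ cong (_* (2 * k)) (length-gateSets c) ⟩
    m * (2 * k)                                      ≡⟨ *-comm m (2 * k) ⟩
    2 * k * m                                        ∎
    where
    open ≤-Reasoning
    charge-tree : ∀ {T} → T ∈ₗ 𝓡 → 3 * (∣ T ∣ ∸ 1) ≤ gateSum (charge T) c
    charge-tree T∈𝓡 with v , Sv≡T ← builds T∈𝓡 = charge-built c v T∈𝓡 Sv≡T

#containing-mono : ∀ {n} X {𝒰 𝒯 : Family n} → 𝒰 ⊑ 𝒯 → #containing X 𝒰 ≤ #containing X 𝒯
#containing-mono X 𝒰⊑𝒯 = length-mono-≤ (filter⁺-⊑ (X ⊆?_) (X ⊆?_) (λ { refl X⊆T → X⊆T }) 𝒰⊑𝒯)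

module _ {n k i : ℕ} where

  WhileLoop⇒⊑ : ∀ {𝒯 𝒰 : Family n} → WhileLoop k i 𝒯 𝒰 → 𝒰 ⊑ 𝒯
  WhileLoop⇒⊑ (done _)        = ⊑-refl
  WhileLoop⇒⊑ (step s _ loop) = ⊑-trans (WhileLoop⇒⊑ loop) (filter-⊑ (λ T → ¬? (s ⊆? T)) _)

  WhileLoop⇒exhausted : ∀ {𝒯 𝒰 : Family n} → WhileLoop k i 𝒯 𝒰 → ¬ Σ (Subset n) (Qualifies k i 𝒰)
  WhileLoop⇒exhausted (done none)     = none
  WhileLoop⇒exhausted (step _ _ loop) = WhileLoop⇒exhausted loop

module _ {n k : ℕ} where

  Rounds⇒⊑ : ∀ {i N} {𝒯 𝒰 : Family n} → Rounds k i N 𝒯 𝒰 → 𝒰 ⊑ 𝒯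
  Rounds⇒⊑ (stop _)             = ⊑-refl
  Rounds⇒⊑ (next _ loop rounds) = ⊑-trans (Rounds⇒⊑ rounds) (WhileLoop⇒⊑ loop)

  -- Round c stopped at a family containing 𝒰, in which X lies in at least c trees,
  -- so X must fail the size condition of round c.
  Rounds⇒unqualified : ∀ {i N} {𝒯 𝒰 : Family n} → Rounds k i N 𝒯 𝒰 →
                       ∀ X → i ≤ #containing X 𝒰 → #containing X 𝒰 ≤ N →
                       ¬ (#containing X 𝒰 * k ≤ 3 * (#containing X 𝒰 ∸ 1) * ∣ X ∣)
  Rounds⇒unqualified (stop N<i) X i≤c c≤N _ = <⇒≱ N<i (≤-trans i≤c c≤N)
  Rounds⇒unqualified (next _ loop rounds) X i≤c c≤N with m≤n⇒m<n∨m≡n i≤c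
  ... | inj₁ i<c  = Rounds⇒unqualified rounds X i<c c≤N
  ... | inj₂ refl = λ large → WhileLoop⇒exhausted loop (X , large , #containing-mono X (Rounds⇒⊑ rounds))

∣T∣≤maxSize : ∀ {n T} (𝒯 : Family n) → T ∈ₗ 𝒯 → ∣ T ∣ ≤ maxSize 𝒯
∣T∣≤maxSize (T ∷ 𝒯) (here refl) = m≤m⊔n ∣ T ∣ (maxSize 𝒯)
∣T∣≤maxSize (T ∷ 𝒯) (there T∈) = ≤-trans (∣T∣≤maxSize 𝒯 T∈) (m≤n⊔m ∣ T ∣ (maxSize 𝒯))

procedure-reduced : ∀ {n} {𝒯 𝓡 : Family n} → Unique 𝒯 → Procedure 𝒯 𝓡 → Reduced (maxSize 𝒯) 𝓡
procedure-reduced {𝒯 = 𝒯} {𝓡} unique-𝒯 rounds = record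
  { unique               = Unique-resp-⊑ 𝓡⊑𝒯₁ (Uniqueₚ.filter⁺ keep? unique-𝒯)
  ; size≤                = ∣T∣≤maxSize 𝒯 ∘ proj₁ ∘ survives
  ; proper-subtree-small = λ X∈𝓡 T∈𝓡 X⊂T → ≰⇒> λ large →
                             proj₂ (survives T∈𝓡) (lose (proj₁ (survives X∈𝓡)) (X⊂T , large))
  ; shared-subset-small  = λ X 2≤# → ≰⇒> (Rounds⇒unqualified rounds X 2≤#
                             (≤-trans (length-filter (X ⊆?_) 𝓡) (length-mono-≤ 𝓡⊑𝒯₁)))
  }
  where
  k : ℕ
  k = maxSize 𝒯
  keep? : Decidable (λ T → ¬ HasLargeProperSubtree k 𝒯 T)
  keep? T = ¬? (hasLargeProperSubtree? k 𝒯 T)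
  𝓡⊑𝒯₁ : 𝓡 ⊑ removeSupersets k 𝒯
  𝓡⊑𝒯₁ = Rounds⇒⊑ rounds
  survives : ∀ {T} → T ∈ₗ 𝓡 → T ∈ₗ 𝒯 × ¬ HasLargeProperSubtree k 𝒯 T
  survives T∈𝓡 = ∈-filter⁻ keep? (Any-resp-⊆ 𝓡⊑𝒯₁ T∈𝓡)

lemma17 : ∀ {n} (𝒯 𝓡 : Family n) → Unique 𝒯 → Procedure 𝒯 𝓡 →
          ∀ m → IsOpt 𝓡 m →
          3 * separateCost 𝓡 ≤ 2 * maxSize 𝒯 * m
lemma17 𝒯 𝓡 unique-𝒯 procedure m ((c , _ , builds) , _) =
  Charging.separateCost-bound (procedure-reduced unique-𝒯 procedure) c builds
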